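{- Let $\phi$ be a linear-exponential program with divisions and let $x$ be a variable occurring linearly in $\phi$. Then the set of solutions of $\phi$ is $(x,\mathrm{mod}(x,\phi))$-periodic: for every solution $\nu$ of $\phi$ and every integer $m\ge \mathrm{mod}(x,\phi)$ such that $\nu+[x\mapsto m]$ is also a solution, the map $\nu+[x\mapsto \mathrm{mod}(x,\phi)]$ is a solution of $\phi$.
   Context: A linear-exponential term is $\sum_{i}\big(a_i x_i + b_i 2^{x_i} + \sum_{j} c_{i,j}(x_i\bmod 2^{x_j})\big)+d$ with integer coefficients. A linear-exponential program with divisions is a finite conjunction of constraints $\tau=0$, $\tau\le0$ and $d\mid\tau$ (with $d\ge1$ an integer and $\tau$ a linear-exponential term); its variables range over $\mathbb{N}$ and a solution is a map assigning natural numbers to its variables satisfying all constraints. A variable $x$ occurs linearly in $\phi$ if it occurs only in monomials $a\cdot x$ (never in $2^x$ nor inside any remainder term $(\cdot\bmod 2^{\cdot})$). $\mathrm{mod}(x,\phi)$ is the least common multiple of the divisors $d$ of the divisibility constraints $d\mid\tau$ of $\phi$ in which $x$ occurs with non-zero coefficient (equal to $1$ if there are none). For a map $\nu$, $\nu+[x\mapsto m]$ denotes the map obtained from $\nu$ by adding $m$ to the value of $x$. -}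

module Defs where

open import Data.Nat as ℕ using (ℕ; zero; suc; NonZero; _^_; _%_)
open import Data.Nat.Properties using (m^n≢0)
open import Data.Nat.LCM using (lcm)
open import Data.Integer as ℤ using (ℤ; +_; 0ℤ)
open import Data.Integer.Divisibility using () renaming (_∣_ to _∣ℤ_)
open import Data.Fin using (Fin; zero; suc)
open import Data.Fin.Properties using () renaming (_≟_ to _≟F_)
open import Data.List using (List; []; _∷_)
open import Data.List.Relation.Unary.All using (All)
open import Data.Product using (_×_)
open import Relation.Nullary using (yes; no)
open import Relation.Binary.PropositionalEquality using (_≡_)

Valuation : ℕ → Set
Valuation n = Fin n → ℕ

sumℤ : ∀ {n} → (Fin n → ℤ) → ℤ
sumℤ {zero}  f = 0ℤ
sumℤ {suc n} f = f zero ℤ.+ sumℤ (λ i → f (suc i))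

_mod2^_ : ℕ → ℕ → ℕ
x mod2^ y = _%_ x (2 ^ y) {{m^n≢0 2 y}}

-- Linear-exponential term
--   Σ_i ( a_i x_i + b_i 2^{x_i} + Σ_j c_{i,j} (x_i mod 2^{x_j}) ) + d
record Term (n : ℕ) : Set where
  constructor term
  field
    a : Fin n → ℤ
    b : Fin n → ℤ
    c : Fin n → Fin n → ℤ
    d : ℤ
open Term public

eval : ∀ {n} → Term n → Valuation n → ℤ
eval t ν =
  sumℤ (λ i → (a t i ℤ.* + ν i)
             ℤ.+ (b t i ℤ.* + (2 ^ ν i))
             ℤ.+ sumℤ (λ j → c t i j ℤ.* + (ν i mod2^ ν j)))
  ℤ.+ d t

data Constraint (n : ℕ) : Set where
  eq0 : Term n → Constraint n
  le0 : Term n → Constraint n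
  dvd : (d : ℕ) → .{{NonZero d}} → Term n → Constraint n

Program : ℕ → Set
Program n = List (Constraint n)

SatC : ∀ {n} → Constraint n → Valuation n → Set
SatC (eq0 τ)   ν = eval τ ν ≡ 0ℤ
SatC (le0 τ)   ν = eval τ ν ℤ.≤ 0ℤ
SatC (dvd d τ) ν = (+ d) ∣ℤ eval τ ν

Solution : ∀ {n} → Program n → Valuation n → Set
Solution φ ν = All (λ C → SatC C ν) φ

termOf : ∀ {n} → Constraint n → Term n
termOf (eq0 τ)   = τ
termOf (le0 τ)   = τ
termOf (dvd d τ) = τ

LinearIn : ∀ {n} → Fin n → Term n → Set
LinearIn x τ =
  (b τ x ≡ 0ℤ) ×
  (∀ j → c τ x j ≡ 0ℤ) ×
  (∀ i → c τ i x ≡ 0ℤ)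

OccursLinearly : ∀ {n} → Fin n → Program n → Set
OccursLinearly x φ = All (λ C → LinearIn x (termOf C)) φ

modx : ∀ {n} → Fin n → Program n → ℕ
modx x [] = 1
modx x (eq0 τ ∷ φ) = modx x φ
modx x (le0 τ ∷ φ) = modx x φ
modx x (dvd d τ ∷ φ) with a τ x ℤ.≟ 0ℤ
... | yes _ = modx x φ
... | no  _ = lcm d (modx x φ)

_+[_↦_] : ∀ {n} → Valuation n → Fin n → ℕ → Valuation n
(ν +[ x ↦ m ]) i with i ≟F x
... | yes _ = ν i ℕ.+ m
... | no  _ = ν i

-- Because x occurs linearly, shifting x by k changes the value of every term τ
-- by exactly a_x·k. Along such a line k ↦ e + a_x·k the solution sets of τ = 0
-- and τ ≤ 0 are intervals, so a constraint holding at k = 0 and k = m holds at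
-- every k ≤ m; and d ∣ τ is preserved by any shift that is a multiple of d
-- whenever a_x ≠ 0. The shift mod(x, φ) ≤ m is a multiple of all such d.
module Submission where

open import Defs
open import Data.Nat as ℕ using (ℕ; _≤_; z≤n; _^_)
open import Data.Nat.Divisibility as ℕ∣ using () renaming (_∣_ to _∣ℕ_)
open import Data.Nat.LCM using (m∣lcm[m,n]; n∣lcm[m,n])
open import Data.Integer as ℤ using (ℤ; +_; -[1+_]; 0ℤ; _+_; _*_)
open import Data.Integer.Properties
  using (pos-+; +-assoc; +-identityˡ; +-identityʳ; *-zeroʳ; i*j≡0⇒i≡0∨j≡0; +-monoʳ-≤; ≤-trans; ≤-reflexive;
         *-monoˡ-≤-nonNeg; *-monoˡ-≤-nonPos)
open import Data.Integer.Divisibility using () renaming (_∣_ to _∣ᵤ_)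
open import Data.Integer.Divisibility.Signed using (_∣_; divides; ∣ᵤ⇒∣; ∣⇒∣ᵤ; ∣m∣n⇒∣m+n; ∣n⇒∣m*n)
open import Data.Integer.Tactic.RingSolver using (solve-∀)
open import Data.Fin using (Fin; zero; suc)
open import Data.Fin.Properties using (suc-injective) renaming (_≟_ to _≟F_)
open import Data.List using ([]; _∷_)
open import Data.List.Relation.Unary.All using ([]; _∷_)
open import Data.Product using (proj₁; proj₂)
open import Data.Sum using (inj₁; inj₂)
open import Data.Empty using (⊥-elim)
open import Relation.Nullary using (yes; no)
open import Relation.Binary.PropositionalEquality
open ≡-Reasoning

+-right-comm : ∀ p q r → p + q + r ≡ p + r + q
+-right-comm = solve-∀

sumℤ-cong : ∀ {n} {f g : Fin n → ℤ} → (∀ i → f i ≡ g i) → sumℤ f ≡ sumℤ g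
sumℤ-cong {ℕ.zero}  f≗g = refl
sumℤ-cong {ℕ.suc n} f≗g = cong₂ _+_ (f≗g zero) (sumℤ-cong (λ i → f≗g (suc i)))

sumℤ-perturb : ∀ {n} (f g : Fin n → ℤ) (x : Fin n) (δ : ℤ) →
               (∀ i → i ≢ x → f i ≡ g i) → f x ≡ g x + δ → sumℤ f ≡ sumℤ g + δ
sumℤ-perturb f g zero δ f≗g fx≡gx+δ = begin
  f zero + sumℤ (λ i → f (suc i))  ≡⟨ cong₂ _+_ fx≡gx+δ (sumℤ-cong (λ i → f≗g (suc i) (λ ()))) ⟩
  g zero + δ + sumℤ (λ i → g (suc i)) ≡⟨ +-right-comm (g zero) δ _ ⟩
  g zero + sumℤ (λ i → g (suc i)) + δ ∎
sumℤ-perturb f g (suc x) δ f≗g fx≡gx+δ = begin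
  f zero + sumℤ (λ i → f (suc i))  ≡⟨ cong₂ _+_ (f≗g zero (λ ())) tail≡ ⟩
  g zero + (sumℤ (λ i → g (suc i)) + δ) ≡⟨ +-assoc (g zero) _ δ ⟨
  g zero + sumℤ (λ i → g (suc i)) + δ ∎
  where
  tail≡ : sumℤ (λ i → f (suc i)) ≡ sumℤ (λ i → g (suc i)) + δ
  tail≡ = sumℤ-perturb (λ i → f (suc i)) (λ i → g (suc i)) x δ
            (λ i i≢x → f≗g (suc i) (λ eq → i≢x (suc-injective eq))) fx≡gx+δ

module _ {n : ℕ} (ν : Valuation n) (x : Fin n) (k : ℕ) where

  +[↦]-at : (ν +[ x ↦ k ]) x ≡ ν x ℕ.+ k
  +[↦]-at with x ≟F x
  ... | yes _   = refl
  ... | no x≢x = ⊥-elim (x≢x refl)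

  +[↦]-other : ∀ {i} → i ≢ x → (ν +[ x ↦ k ]) i ≡ ν i
  +[↦]-other {i} i≢x with i ≟F x
  ... | yes i≡x = ⊥-elim (i≢x i≡x)
  ... | no _    = refl

contribution : ∀ {n} → Term n → Valuation n → Fin n → ℤ
contribution τ ν i = a τ i * + ν i + b τ i * + (2 ^ ν i) + sumℤ (λ j → c τ i j * + (ν i mod2^ ν j))

zero-coeff : ∀ {c} p q → c ≡ 0ℤ → c * p ≡ c * q
zero-coeff p q refl = refl

module _ {n : ℕ} (τ : Term n) (x : Fin n) (lin : LinearIn x τ) (ν : Valuation n) (k : ℕ) where

  private
    ν′ : Valuation n
    ν′ = ν +[ x ↦ k ]
    bₓ≡0 : b τ x ≡ 0ℤ
    bₓ≡0 = proj₁ lin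
    cₓⱼ≡0 : ∀ j → c τ x j ≡ 0ℤ
    cₓⱼ≡0 = proj₁ (proj₂ lin)
    cᵢₓ≡0 : ∀ i → c τ i x ≡ 0ℤ
    cᵢₓ≡0 = proj₂ (proj₂ lin)

  remainders-shift : ∀ i → sumℤ (λ j → c τ i j * + (ν′ i mod2^ ν′ j)) ≡ sumℤ (λ j → c τ i j * + (ν i mod2^ ν j))
  remainders-shift i = sumℤ-cong remainder
    where
    remainder : ∀ j → c τ i j * + (ν′ i mod2^ ν′ j) ≡ c τ i j * + (ν i mod2^ ν j)
    remainder j with i ≟F x | j ≟F x
    ... | yes refl | _        = zero-coeff _ _ (cₓⱼ≡0 j)
    ... | no i≢x  | yes refl = zero-coeff _ _ (cᵢₓ≡0 i)
    ... | no i≢x  | no j≢x   = refl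

  contribution-other : ∀ {i} → i ≢ x → contribution τ ν′ i ≡ contribution τ ν i
  contribution-other {i} i≢x =
    cong₂ (λ u s → a τ i * + u + b τ i * + (2 ^ u) + s) (+[↦]-other ν x k i≢x) (remainders-shift i)

  contribution-at : contribution τ ν′ x ≡ contribution τ ν x + a τ x * + k
  contribution-at = begin
    a τ x * + ν′ x + b τ x * + (2 ^ ν′ x) + sumℤ (λ j → c τ x j * + (ν′ x mod2^ ν′ j))
      ≡⟨ cong₂ _+_ (cong₂ _+_ (cong (λ u → a τ x * + u) (+[↦]-at ν x k)) (zero-coeff _ _ bₓ≡0))
                   (remainders-shift x) ⟩
    a τ x * + (ν x ℕ.+ k) + B + S
      ≡⟨ cong (λ u → a τ x * u + B + S) (pos-+ (ν x) k) ⟩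
    a τ x * (+ ν x + + k) + B + S
      ≡⟨ distrib (a τ x) (+ ν x) (+ k) B S ⟩
    contribution τ ν x + a τ x * + k ∎
    where
    B S : ℤ
    B = b τ x * + (2 ^ ν x)
    S = sumℤ (λ j → c τ x j * + (ν x mod2^ ν j))
    distrib : ∀ A u v B S → A * (u + v) + B + S ≡ (A * u + B + S) + A * v
    distrib = solve-∀

  eval-shift : eval τ ν′ ≡ eval τ ν + a τ x * + k
  eval-shift = begin
    sumℤ (contribution τ ν′) + d τ
      ≡⟨ cong (_+ d τ) (sumℤ-perturb _ _ x _ (λ i → contribution-other) contribution-at) ⟩
    sumℤ (contribution τ ν) + a τ x * + k + d τ
      ≡⟨ +-right-comm (sumℤ (contribution τ ν)) _ (d τ) ⟩
    sumℤ (contribution τ ν) + d τ + a τ x * + k ∎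

+-*-≡0-between : ∀ {e} A {m k} → e ≡ 0ℤ → e + A * + m ≡ 0ℤ → k ≤ m → e + A * + k ≡ 0ℤ
+-*-≡0-between A refl Am≡0 k≤m with i*j≡0⇒i≡0∨j≡0 A (trans (sym (+-identityˡ _)) Am≡0)
+-*-≡0-between A refl Am≡0 k≤m | inj₁ refl = refl
+-*-≡0-between A refl Am≡0 z≤n | inj₂ refl = trans (+-identityˡ _) (*-zeroʳ A)

+-*-≤0-between : ∀ {e} A {m k} → e ℤ.≤ 0ℤ → e + A * + m ℤ.≤ 0ℤ → k ≤ m → e + A * + k ℤ.≤ 0ℤ
+-*-≤0-between {e} A@(+ _) e≤0 e+Am≤0 k≤m =
  ≤-trans (+-monoʳ-≤ e (*-monoˡ-≤-nonNeg A (ℤ.+≤+ k≤m))) e+Am≤0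
+-*-≤0-between {e} A@(-[1+ _ ]) {k = k} e≤0 e+Am≤0 k≤m =
  ≤-trans (+-monoʳ-≤ e Ak≤0) (≤-trans (≤-reflexive (+-identityʳ e)) e≤0)
  where
  Ak≤0 : A * + k ℤ.≤ 0ℤ
  Ak≤0 = subst (A * + k ℤ.≤_) (*-zeroʳ A) (*-monoˡ-≤-nonPos A (ℤ.+≤+ z≤n))

modx[φ]∣modx[C∷φ] : ∀ {n} (x : Fin n) (C : Constraint n) (φ : Program n) → modx x φ ∣ℕ modx x (C ∷ φ)
modx[φ]∣modx[C∷φ] x (eq0 τ)   φ = ℕ∣.∣-refl
modx[φ]∣modx[C∷φ] x (le0 τ)   φ = ℕ∣.∣-refl
modx[φ]∣modx[C∷φ] x (dvd d τ) φ with a τ x ℤ.≟ 0ℤ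
... | yes _ = ℕ∣.∣-refl
... | no  _ = n∣lcm[m,n] d (modx x φ)

modx∣k⇒d∣aₓ*k : ∀ {n} (x : Fin n) d .{{_ : ℕ.NonZero d}} (τ : Term n) (φ : Program n) {k} →
                          modx x (dvd d τ ∷ φ) ∣ℕ k → + d ∣ a τ x * + k
modx∣k⇒d∣aₓ*k x d τ φ M∣k with a τ x ℤ.≟ 0ℤ
... | yes aₓ≡0 rewrite aₓ≡0 = divides 0ℤ refl
... | no  _    = ∣n⇒∣m*n (a τ x) (∣ᵤ⇒∣ (ℕ∣.∣-trans (m∣lcm[m,n] d (modx x φ)) M∣k))

solution-+[↦]-multiple : ∀ {n} (φ : Program n) (x : Fin n) → OccursLinearly x φ →
                         (ν : Valuation n) → Solution φ ν →
                         (m k : ℕ) → Solution φ (ν +[ x ↦ m ]) → k ≤ m → modx x φ ∣ℕ k →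
                         Solution φ (ν +[ x ↦ k ])
solution-+[↦]-multiple [] x [] ν [] m k [] k≤m M∣k = []
solution-+[↦]-multiple (C ∷ φ) x (lin ∷ lins) ν (sat ∷ sats) m k (sat′ ∷ sats′) k≤m M∣k =
  shifted C lin sat sat′ M∣k
  ∷ solution-+[↦]-multiple φ x lins ν sats m k sats′ k≤m (ℕ∣.∣-trans (modx[φ]∣modx[C∷φ] x C φ) M∣k)
  where
  shifted : ∀ C → LinearIn x (termOf C) → SatC C ν → SatC C (ν +[ x ↦ m ]) → modx x (C ∷ φ) ∣ℕ k →
            SatC C (ν +[ x ↦ k ])
  shifted (eq0 τ) lin sat sat′ _ = subst (_≡ 0ℤ) (sym (eval-shift τ x lin ν k))
    (+-*-≡0-between (a τ x) sat (trans (sym (eval-shift τ x lin ν m)) sat′) k≤m)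
  shifted (le0 τ) lin sat sat′ _ = subst (ℤ._≤ 0ℤ) (sym (eval-shift τ x lin ν k))
    (+-*-≤0-between (a τ x) sat (subst (ℤ._≤ 0ℤ) (eval-shift τ x lin ν m) sat′) k≤m)
  shifted (dvd d τ) lin sat sat′ M∣k = subst (+ d ∣ᵤ_) (sym (eval-shift τ x lin ν k))
    (∣⇒∣ᵤ {+ d} {eval τ ν + a τ x * + k}
      (∣m∣n⇒∣m+n (∣ᵤ⇒∣ {+ d} {eval τ ν} sat) (modx∣k⇒d∣aₓ*k x d τ φ M∣k)))

lemma11 : ∀ {n} (φ : Program n) (x : Fin n) → OccursLinearly x φ →
          (ν : Valuation n) → Solution φ ν →
          (m : ℕ) → modx x φ ≤ m → Solution φ (ν +[ x ↦ m ]) →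
          Solution φ (ν +[ x ↦ modx x φ ])
lemma11 φ x lin ν sat m M≤m sat′ =
  solution-+[↦]-multiple φ x lin ν sat m (modx x φ) sat′ M≤m ℕ∣.∣-refl
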